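{- Let $G$ be a connected graph with no subgraph isomorphic to $Y$, and let $P=v_0v_1\dots v_\ell$ be a longest path in $G$, chosen subject to that to minimize $\deg(v_0)+\deg(v_\ell)$, with $\ell\ge5$. For $0\le i\le\ell$ let $L_i=N_G(v_i)\setminus V(P)$. Assume $G$ has no edge $v_av_b$ with $a\in\{0,1\}$, $b\in\{\ell-1,\ell\}$, and $L_1\cap L_{\ell-1}=\emptyset$. If $v_{i-1}v_{i+1}\in E(G)$ where $2\le i\le\ell-2$, then $L_i=\emptyset$.
   Context: All graphs are finite and simple. $Y$ is the 7-vertex tree obtained from $K_{1,3}$ by subdividing each edge exactly once. -}

module Defs where

open import Data.Nat using (ℕ; zero; suc; _+_; _≤_; _<_; _∸_)
open import Data.Fin using (Fin; toℕ)
open import Data.Bool using (Bool; true; false; _∨_; if_then_else_)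
open import Data.Bool.Properties using (∨-comm)
open import Data.List using (List; map; allFin)
open import Data.Nat.ListAction using (sum)
open import Data.Product using (Σ; _×_; ∃; _,_)
open import Relation.Binary.PropositionalEquality using (_≡_; refl)
open import Relation.Nullary using (¬_)
open import Function.Definitions using (Injective)

record Graph (n : ℕ) : Set where
  field
    adj     : Fin n → Fin n → Bool
    adj-sym : ∀ u v → adj u v ≡ adj v u
    adj-irr : ∀ v → adj v v ≡ false
open Graph public

Edge : ∀ {n} → Graph n → Fin n → Fin n → Set
Edge G u v = adj G u v ≡ true

deg : ∀ {n} → Graph n → Fin n → ℕ
deg {n} G v = sum (map (λ u → if adj G v u then 1 else 0) (allFin n))

data Reach {n} (G : Graph n) : Fin n → Fin n → Set where
  here : ∀ {u} → Reach G u u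
  step : ∀ {u v w} → Edge G u v → Reach G v w → Reach G u w

Connected : ∀ {n} → Graph n → Set
Connected {n} G = ∀ (u v : Fin n) → Reach G u v

SubgraphOf : ∀ {m n} → Graph m → Graph n → Set
SubgraphOf {m} {n} H G =
  Σ (Fin m → Fin n) λ f → Injective _≡_ _≡_ f × (∀ u v → Edge H u v → Edge G (f u) (f v))

-- The tree Y: centre 0, middle vertices 1,2,3, leaves 4,5,6 (edges 0-1,0-2,0-3,1-4,2-5,3-6)
yE : ℕ → ℕ → Bool
yE 0 1 = true
yE 0 2 = true
yE 0 3 = true
yE 1 4 = true
yE 2 5 = true
yE 3 6 = true
yE _ _ = false

yE-irr : ∀ k → yE k k ≡ false
yE-irr 0 = refl
yE-irr 1 = refl
yE-irr 2 = refl
yE-irr 3 = refl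
yE-irr 4 = refl
yE-irr 5 = refl
yE-irr 6 = refl
yE-irr (suc (suc (suc (suc (suc (suc (suc k))))))) = refl

Y : Graph 7
Y = record
  { adj = λ u v → yE (toℕ u) (toℕ v) ∨ yE (toℕ v) (toℕ u)
  ; adj-sym = λ u v → ∨-comm (yE (toℕ u) (toℕ v)) (yE (toℕ v) (toℕ u))
  ; adj-irr = λ v → irr (toℕ v)
  }
  where
  irr : ∀ k → yE k k ∨ yE k k ≡ false
  irr k with yE k k | yE-irr k
  ... | false | refl = refl

-- A path v_0 v_1 ... v_ℓ of length ℓ (ℓ edges), given as ℕ-indexed vertices
-- (values at indices > ℓ are irrelevant): distinct vertices, consecutive ones adjacent.
record Path {n} (G : Graph n) (ℓ : ℕ) : Set where
  field
    v    : ℕ → Fin n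
    inj  : ∀ i j → i ≤ ℓ → j ≤ ℓ → v i ≡ v j → i ≡ j
    adjc : ∀ i → i < ℓ → Edge G (v i) (v (suc i))
open Path public

OnPath : ∀ {n} {G : Graph n} {ℓ} → Path G ℓ → Fin n → Set
OnPath {ℓ = ℓ} P w = ∃ λ i → i ≤ ℓ × v P i ≡ w

InL : ∀ {n} {G : Graph n} {ℓ} → Path G ℓ → ℕ → Fin n → Set
InL {G = G} P i w = Edge G (v P i) w × ¬ OnPath P w

Longest : ∀ {n} {G : Graph n} {ℓ} → Path G ℓ → Set
Longest {G = G} {ℓ} P = ∀ m → Path G m → m ≤ ℓ

MinEndDeg : ∀ {n} {G : Graph n} {ℓ} → Path G ℓ → Set
MinEndDeg {G = G} {ℓ} P =
  ∀ (Q : Path G ℓ) → deg G (v P 0) + deg G (v P ℓ) ≤ deg G (v Q 0) + deg G (v Q ℓ)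

-- A chord v_{i-1}v_{i+1} lets v_{i-1} see three path neighbours v_{i-2}, v_i, v_{i+1};
-- extending them by v_{i-3}, a vertex w ∈ L_i and v_{i+2} gives a spider Y centred at
-- v_{i-1}. This needs i ≥ 3; for i = 2 the mirror image centred at v_3 (legs ending
-- in v_0, w, v_5) works, and the mirror image is obtained by reading the path backwards.
module Submission where

open import Defs
open import Data.Nat using (ℕ; zero; suc; _+_; _∸_; _≤_; _<_; _<?_; s≤s; z≤n)
open import Data.Nat.Properties
  using (≤-trans; +-monoˡ-≤; +-cancelʳ-≡; +-comm; m∸n≤m; ∸-cancelˡ-≡; +-∸-assoc; m≤o∸n⇒m+n≤o)
open import Data.Bool using (true)
open import Data.Bool.Properties using () renaming (_≟_ to _≟ᵇ_)
open import Data.Fin using (Fin; zero; suc; toℕ; #_; _≟_)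
open import Data.Fin.Properties using (all?; toℕ-injective; toℕ≤pred[n])
open import Data.Maybe using (Maybe; just; nothing)
open import Data.Maybe.Properties using (≡-dec)
open import Data.Vec using (_∷_; []; lookup)
open import Data.Product using (_×_; _,_)
open import Data.Sum using (_⊎_; inj₁; inj₂)
open import Data.Empty using (⊥-elim)
open import Function using (_∘_)
open import Function.Definitions using (Injective)
open import Relation.Binary.PropositionalEquality using (_≡_; _≢_; refl; sym; trans; cong; subst)
open import Relation.Nullary using (¬_; Dec)
open import Relation.Nullary.Decidable using (toWitness; from-yes; ¬?; _×-dec_; _⊎-dec_; _→-dec_)
open import Relation.Unary using (_⊆_)

Edge-sym : ∀ {n} (G : Graph n) {x y} → Edge G x y → Edge G y x
Edge-sym G {x} {y} e = trans (adj-sym G y x) e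

parent : Fin 7 → Fin 7
parent = lookup (# 0 ∷ # 0 ∷ # 0 ∷ # 0 ∷ # 1 ∷ # 2 ∷ # 3 ∷ [])

ChildOf : Fin 7 → Fin 7 → Set
ChildOf c p = c ≢ # 0 × p ≡ parent c

Y-edge⇒child : ∀ a b → Edge Y a b → ChildOf b a ⊎ ChildOf a b
Y-edge⇒child = toWitness {a? = all? λ a → all? λ b →
  (adj Y a b ≟ᵇ true) →-dec (childOf? b a ⊎-dec childOf? a b)} _
  where
  childOf? : ∀ c p → Dec (ChildOf c p)
  childOf? c p = ¬? (c ≟ # 0) ×-dec (p ≟ parent c)

parent-edges⇒Y⊆ : ∀ {n} (G : Graph n) (g : Fin 7 → Fin n) → Injective _≡_ _≡_ g →
  (∀ c → c ≢ # 0 → Edge G (g (parent c)) (g c)) → SubgraphOf Y G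
parent-edges⇒Y⊆ G g g-injective parent-edge = g , g-injective , edge
  where
  edge : ∀ a b → Edge Y a b → Edge G (g a) (g b)
  edge a b e with Y-edge⇒child a b e
  ... | inj₁ (b≢0 , refl) = parent-edge b b≢0
  ... | inj₂ (a≢0 , refl) = Edge-sym G (parent-edge a a≢0)

module _ {n} {G : Graph n} {ℓ : ℕ} where

  window : (P : Path G ℓ) (j : ℕ) {m : ℕ} → m + j ≤ ℓ → Path G m
  window P j {m} m+j≤ℓ = record
    { v    = λ k → v P (k + j)
    ; inj  = λ a b a≤m b≤m eq → +-cancelʳ-≡ j a b (inj P _ _ (shift a≤m) (shift b≤m) eq)
    ; adjc = λ k k<m → adjc P (k + j) (shift k<m)
    }
    where
    shift : ∀ {k} → k ≤ m → k + j ≤ ℓ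
    shift k≤m = ≤-trans (+-monoˡ-≤ j k≤m) m+j≤ℓ

  window-⊆ : (P : Path G ℓ) (j : ℕ) {m : ℕ} (m+j≤ℓ : m + j ≤ ℓ) →
             OnPath (window P j m+j≤ℓ) ⊆ OnPath P
  window-⊆ P j m+j≤ℓ (k , k≤m , eq) = k + j , ≤-trans (+-monoˡ-≤ j k≤m) m+j≤ℓ , eq

  reverse : Path G ℓ → Path G ℓ
  reverse P = record
    { v    = λ k → v P (ℓ ∸ k)
    ; inj  = λ a b a≤ℓ b≤ℓ eq → ∸-cancelˡ-≡ a≤ℓ b≤ℓ (inj P _ _ (m∸n≤m ℓ a) (m∸n≤m ℓ b) eq)
    ; adjc = adjc-reverse
    }
    where
    adjc-reverse : ∀ k → k < ℓ → Edge G (v P (ℓ ∸ k)) (v P (ℓ ∸ suc k))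
    -- +-∸-assoc 1 k<ℓ : ℓ ∸ k ≡ suc (ℓ ∸ suc k)
    adjc-reverse k k<ℓ with ℓ ∸ k | +-∸-assoc 1 k<ℓ | m∸n≤m ℓ k
    ... | _ | refl | ℓ∸k≤ℓ = Edge-sym G (adjc P (ℓ ∸ suc k) ℓ∸k≤ℓ)

  reverse-⊆ : (P : Path G ℓ) → OnPath (reverse P) ⊆ OnPath P
  reverse-⊆ P (k , _ , eq) = ℓ ∸ k , m∸n≤m ℓ k , eq

  vertexAt : Path G ℓ → Fin n → Maybe (Fin (suc ℓ)) → Fin n
  vertexAt P w nothing  = w
  vertexAt P w (just i) = v P (toℕ i)

  vertexAt-injective : (P : Path G ℓ) {w : Fin n} → ¬ OnPath P w →
                       Injective _≡_ _≡_ (vertexAt P w)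
  vertexAt-injective P w∉P {nothing}  {nothing}  _  = refl
  vertexAt-injective P w∉P {nothing}  {just j}   eq = ⊥-elim (w∉P (toℕ j , toℕ≤pred[n] j , sym eq))
  vertexAt-injective P w∉P {just i}   {nothing}  eq = ⊥-elim (w∉P (toℕ i , toℕ≤pred[n] i , eq))
  vertexAt-injective P w∉P {just i}   {just j}   eq =
    cong just (toℕ-injective (inj P _ _ (toℕ≤pred[n] i) (toℕ≤pred[n] j) eq))

-- Centre v₂, legs v₂v₄v₅, v₂v₃w and v₂v₁v₀ (`nothing` is w).
slot : Fin 7 → Maybe (Fin 6)
slot = lookup (just (# 2) ∷ just (# 4) ∷ just (# 3) ∷ just (# 1) ∷ just (# 5) ∷ nothing ∷ just (# 0) ∷ [])

slot-injective : Injective _≡_ _≡_ slot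
slot-injective {a} {b} = toWitness {a? = all? λ a → all? λ b →
  ≡-dec _≟_ (slot a) (slot b) →-dec (a ≟ b)} _ a b

chord-pendant⇒Y⊆ : ∀ {n} {G : Graph n} (Q : Path G 5) {w : Fin n} → ¬ OnPath Q w →
  Edge G (v Q 2) (v Q 4) → Edge G (v Q 3) w → SubgraphOf Y G
chord-pendant⇒Y⊆ {G = G} Q {w} w∉Q chord pendant =
  parent-edges⇒Y⊆ G (vertexAt Q w ∘ slot) (slot-injective ∘ vertexAt-injective Q w∉Q) edge
  where
  edge : ∀ c → c ≢ # 0 → Edge G (vertexAt Q w (slot (parent c))) (vertexAt Q w (slot c))
  edge zero c≢0 = ⊥-elim (c≢0 refl)
  edge (suc zero) _ = chord
  edge (suc (suc zero)) _ = adjc Q 2 (from-yes (2 <? 5))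
  edge (suc (suc (suc zero))) _ = Edge-sym G (adjc Q 1 (from-yes (1 <? 5)))
  edge (suc (suc (suc (suc zero)))) _ = adjc Q 4 (from-yes (4 <? 5))
  edge (suc (suc (suc (suc (suc zero))))) _ = pendant
  edge (suc (suc (suc (suc (suc (suc zero)))))) _ = Edge-sym G (adjc Q 0 (from-yes (0 <? 5)))

chord-pendant-in-path⇒Y⊆ : ∀ {n} {G : Graph n} {ℓ} (P : Path G ℓ) → 5 ≤ ℓ →
  ∀ i → 2 ≤ i → 2 + i ≤ ℓ → Edge G (v P (i ∸ 1)) (v P (suc i)) →
  ∀ {w} → InL P i w → SubgraphOf Y G
chord-pendant-in-path⇒Y⊆ P _ 0 () _ _ _
chord-pendant-in-path⇒Y⊆ P _ 1 (s≤s ()) _ _ _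
chord-pendant-in-path⇒Y⊆ {G = G} P 5≤ℓ 2 _ _ chord (pendant , w∉P) =
  chord-pendant⇒Y⊆ (reverse (window P 0 5≤ℓ)) (w∉P ∘ window-⊆ P 0 5≤ℓ ∘ reverse-⊆ (window P 0 5≤ℓ))
    (Edge-sym G chord) pendant
chord-pendant-in-path⇒Y⊆ P _ (suc (suc (suc j))) _ 5+j≤ℓ chord (pendant , w∉P) =
  chord-pendant⇒Y⊆ (window P j 5+j≤ℓ) (w∉P ∘ window-⊆ P j 5+j≤ℓ) chord pendant

lemma3p2 : ∀ {n} (G : Graph n) → Connected G → ¬ SubgraphOf Y G →
    ∀ (ℓ : ℕ) (P : Path G ℓ) → Longest P → MinEndDeg P → 5 ≤ ℓ →
    (∀ a b → (a ≡ 0 ⊎ a ≡ 1) → (b ≡ ℓ ∸ 1 ⊎ b ≡ ℓ) → ¬ Edge G (v P a) (v P b)) →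
    (∀ (w : Fin n) → ¬ (InL P 1 w × InL P (ℓ ∸ 1) w)) →
    ∀ (i : ℕ) → 2 ≤ i → i ≤ ℓ ∸ 2 → Edge G (v P (i ∸ 1)) (v P (suc i)) →
    ∀ (w : Fin n) → ¬ InL P i w
lemma3p2 G _ Y⊈G ℓ P _ _ 5≤ℓ _ _ i 2≤i i≤ℓ∸2 chord w w∈Lᵢ =
  Y⊈G (chord-pendant-in-path⇒Y⊆ P 5≤ℓ i 2≤i 2+i≤ℓ chord w∈Lᵢ)
  where
  2+i≤ℓ : 2 + i ≤ ℓ
  2+i≤ℓ = subst (_≤ ℓ) (+-comm i 2) (m≤o∸n⇒m+n≤o i (≤-trans (s≤s (s≤s z≤n)) 5≤ℓ) i≤ℓ∸2)
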